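{- Let $S$ and $S'$ be disjoint finite sets such that $|S|\geq 2$ and $|S'|=\lceil\log_2(|S|+1)\rceil$. Then there exists a prime graph $G$ with vertex set $V(G)=S\cup S'$ such that $S$ and $S'$ are both stable sets in $G$.
   Context: Graphs are finite, simple and undirected. A subset $M\subseteq V(G)$ is a module of $G$ if every $v\in V(G)\setminus M$ is adjacent either to all vertices of $M$ or to none of them; the modules $\emptyset$, $V(G)$ and the singletons are trivial. A graph $G$ is prime if $|V(G)|\geq 4$ and all its modules are trivial. -}

module Defs where

open import Data.Nat using (ℕ; _+_; _≥_)
open import Data.Bool using (Bool; true; false)
open import Data.Fin using (Fin)
open import Data.Sum using (_⊎_)
open import Data.Product using (Σ; _×_; ∃)
open import Relation.Binary.PropositionalEquality using (_≡_)

record Graph (k : ℕ) : Set where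
  field
    adj   : Fin k → Fin k → Bool
    sym   : ∀ u v → adj u v ≡ adj v u
    irrefl : ∀ v → adj v v ≡ false
open Graph public

Subset : ℕ → Set
Subset k = Fin k → Bool

IsModule : ∀ {k} → Graph k → Subset k → Set
IsModule {k} G M =
  ∀ (v : Fin k) → M v ≡ false →
    (∀ x → M x ≡ true → adj G v x ≡ true) ⊎ (∀ x → M x ≡ true → adj G v x ≡ false)

IsTrivial : ∀ {k} → Subset k → Set
IsTrivial {k} M =
  (∀ v → M v ≡ false)
  ⊎ (∀ v → M v ≡ true)
  ⊎ (Σ (Fin k) λ u → (M u ≡ true) × (∀ v → M v ≡ true → v ≡ u))

IsPrime : ∀ {k} → Graph k → Set
IsPrime {k} G = (k ≥ 4) × (∀ M → IsModule G M → IsTrivial M)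

IsStable : ∀ {k} → Graph k → Subset k → Set
IsStable G M = ∀ x y → M x ≡ true → M y ≡ true → adj G x y ≡ false

module Submission where

-- Write the elements of S as the numbers 0 … n-1 and those of S' as the
-- binary positions 0 … m-1, and join i ∈ S to j ∈ S' exactly when the j-th
-- binary digit of i is 0.  Since n < 2 ^ m every i has m significant digits,
-- distinct elements of S have distinct digit strings, and no i is the
-- all-ones string; since 2 ^ (m-1) ≤ n every power 2 ^ j with j < m-1 lies in S.
--
-- Primality is proved through the splitter principle: a vertex adjacent to
-- exactly one of two members of a module belongs to the module.  Starting from
-- any two distinct members of a module M, suitable splitters (a digit position
-- where two numbers differ, a power of two separating two positions, the
-- vertex 0 which sees all of S') force M to contain all vertices.

open import Defs
open import Data.Nat using (ℕ; _+_; _≥_)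
open import Data.Nat.Logarithm using (⌈log₂_⌉)
open import Data.Bool using (Bool; true; false)
open import Data.Fin using (Fin; _↑ˡ_; _↑ʳ_; splitAt)
open import Data.Sum using ([_,_])
open import Data.Product using (Σ; _×_)
open import Relation.Binary.PropositionalEquality using (_≡_)

open import Data.Nat using (zero; suc; _≤_; _<_; _^_; z≤n; s≤s; ⌊_/2⌋; ⌈_/2⌉)
open import Data.Nat.Properties
open import Data.Nat.Logarithm using (⌈log₂⌉-mono-≤; ⌈log₂2^n⌉≡n)
open import Data.Nat.Logarithm.Core using (⌈log2⌉)
open import Data.Nat.Induction using (<-wellFounded)
open import Induction.WellFounded using (Acc; acc)
open import Data.Bool using (not; if_then_else_)
open import Data.Bool.Properties using (¬-not; not-injective) renaming (_≟_ to _≟ᵇ_)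
open import Data.Fin using (toℕ; fromℕ<; join) renaming (zero to fzero; suc to fsuc)
open import Data.Fin.Properties using (splitAt-join; join-splitAt; any?; toℕ<n; toℕ-fromℕ<; toℕ-injective) renaming (_≟_ to _≟ᶠ_)
open import Data.Sum using (_⊎_; inj₁; inj₂)
open import Data.Product using (_,_; proj₁; proj₂)
open import Relation.Nullary using (yes; no; contradiction; _×-dec_; ¬?)
open import Relation.Nullary.Decidable using (decidable-stable)
open import Relation.Binary.Definitions using (tri<; tri≈; tri>)
open import Relation.Binary.PropositionalEquality using (_≢_; refl; trans; cong; cong₂; subst; subst₂; module ≡-Reasoning; ≢-sym) renaming (sym to ≡-sym)

2^suc : ∀ t → 2 ^ suc t ≡ 2 ^ t + 2 ^ t
2^suc t = cong (2 ^ t +_) (+-identityʳ (2 ^ t))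

double-<-reflect : ∀ {a b} → a + a < b + b → a < b
double-<-reflect lt = ≰⇒> (λ b≤a → <⇒≱ lt (+-mono-≤ b≤a b≤a))

odd : ℕ → Bool
odd zero          = false
odd (suc zero)    = true
odd (suc (suc x)) = odd x

bit : ℕ → ℕ → Bool
bit x zero    = odd x
bit x (suc j) = bit ⌊ x /2⌋ j

halving : ∀ x → x ≡ (if odd x then 1 else 0) + (⌊ x /2⌋ + ⌊ x /2⌋)
halving zero          = refl
halving (suc zero)    = refl
halving (suc (suc x)) = begin
  suc (suc x)                                      ≡⟨ cong (λ y → suc (suc y)) (halving x) ⟩
  suc (suc (b + (h + h)))                          ≡⟨ cong suc (≡-sym (+-suc b (h + h))) ⟩
  suc (b + suc (h + h))                            ≡⟨ ≡-sym (+-suc b (suc (h + h))) ⟩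
  b + suc (suc (h + h))                            ≡⟨ cong (λ y → b + suc y) (≡-sym (+-suc h h)) ⟩
  b + (suc h + suc h)                              ∎
  where
  open ≡-Reasoning
  b = if odd x then 1 else 0
  h = ⌊ x /2⌋

odd-half-injective : ∀ {x y} → odd x ≡ odd y → ⌊ x /2⌋ ≡ ⌊ y /2⌋ → x ≡ y
odd-half-injective {x} {y} o h =
  trans (halving x)
    (trans (cong₂ (λ b k → (if b then 1 else 0) + (k + k)) o h) (≡-sym (halving y)))

half-< : ∀ {x k} → x < k + k → ⌊ x /2⌋ < k
half-< {x} {k} lt =
  double-<-reflect (≤-<-trans (m≤n+m (h + h) (if odd x then 1 else 0)) (subst (_< k + k) (halving x) lt))
  where h = ⌊ x /2⌋

odd-half-< : ∀ {x k} → odd x ≡ true → suc x < k + k → suc ⌊ x /2⌋ < k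
odd-half-< {x} {k} o lt = double-<-reflect (subst (_< k + k) x+1≡ lt)
  where
  h = ⌊ x /2⌋
  x+1≡ : suc x ≡ suc h + suc h
  x+1≡ = trans (cong suc (trans (halving x) (cong (λ b → (if b then 1 else 0) + (h + h)) o)))
               (cong suc (≡-sym (+-suc h h)))

bit-zero : ∀ j → bit 0 j ≡ false
bit-zero zero    = refl
bit-zero (suc j) = bit-zero j

bits-separate : ∀ m {x y} → x < 2 ^ m → y < 2 ^ m → x ≢ y →
                Σ (Fin m) λ j → bit x (toℕ j) ≢ bit y (toℕ j)
bits-separate zero    {zero}  {zero}  _       _       x≢y = contradiction refl x≢y
bits-separate zero    {suc _}         (s≤s ()) _      _
bits-separate zero    {zero}  {suc _} _       (s≤s ()) _
bits-separate (suc m) {x}     {y}     x<      y<      x≢y with odd x ≟ᵇ odd y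
... | no  last-differs = fzero , last-differs
... | yes same-last    =
  let j , differs = bits-separate m (half-< (subst (x <_) (2^suc m) x<))
                                    (half-< (subst (y <_) (2^suc m) y<))
                                    (λ h → x≢y (odd-half-injective same-last h))
  in fsuc j , differs

zero-bit : ∀ m {x} → suc x < 2 ^ m → Σ (Fin m) λ j → bit x (toℕ j) ≡ false
zero-bit zero    (s≤s ())
zero-bit (suc m) {x} lt with odd x in parity
... | false = fzero , parity
... | true  = let j , b = zero-bit m (odd-half-< parity (subst (suc x <_) (2^suc m) lt))
              in fsuc j , b

odd-double : ∀ x → odd (x + x) ≡ false
odd-double zero    = refl
odd-double (suc x) rewrite +-suc x x = odd-double x

bit-pow-self : ∀ t → bit (2 ^ t) t ≡ true
bit-pow-self zero    = refl
bit-pow-self (suc t) rewrite 2^suc t | ≡-sym (n≡⌊n+n/2⌋ (2 ^ t)) = bit-pow-self t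

bit-pow-other : ∀ t k → t ≢ k → bit (2 ^ t) k ≡ false
bit-pow-other zero    zero    t≢k = contradiction refl t≢k
bit-pow-other zero    (suc k) _   = bit-zero k
bit-pow-other (suc t) zero    _   rewrite 2^suc t = odd-double (2 ^ t)
bit-pow-other (suc t) (suc k) t≢k rewrite 2^suc t | ≡-sym (n≡⌊n+n/2⌋ (2 ^ t)) =
  bit-pow-other t k (λ t≡k → t≢k (cong suc t≡k))

≤2^⌈log2⌉ : ∀ x (rec : Acc _<_ x) → x ≤ 2 ^ ⌈log2⌉ x rec
≤2^⌈log2⌉ zero                _         = z≤n
≤2^⌈log2⌉ (suc zero)          _         = s≤s z≤n
≤2^⌈log2⌉ (suc (suc x)) (acc rs) = begin
  2 + x                      ≡⟨ cong (2 +_) (≡-sym (⌊n/2⌋+⌈n/2⌉≡n x)) ⟩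
  2 + (⌊ x /2⌋ + h)          ≤⟨ +-monoʳ-≤ 2 (+-monoˡ-≤ h (⌊n/2⌋≤⌈n/2⌉ x)) ⟩
  2 + (h + h)                ≡⟨ cong suc (≡-sym (+-suc h h)) ⟩
  suc h + suc h              ≤⟨ +-mono-≤ ih ih ⟩
  2 ^ c + 2 ^ c              ≡⟨ ≡-sym (2^suc c) ⟩
  2 ^ suc c                  ∎
  where
  open ≤-Reasoning
  h   = ⌈ x /2⌉
  c   = ⌈log2⌉ (suc h) (rs (⌈n/2⌉<n x))
  ih  = ≤2^⌈log2⌉ (suc h) (rs (⌈n/2⌉<n x))

≤2^⌈log₂⌉ : ∀ x → x ≤ 2 ^ ⌈log₂ x ⌉
≤2^⌈log₂⌉ x = ≤2^⌈log2⌉ x (<-wellFounded x)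

log-bounds : ∀ n p → suc p ≡ ⌈log₂ (n + 1) ⌉ → n < 2 ^ suc p × 2 ^ p ≤ n
log-bounds n p eq = upper , lower
  where
  upper : n < 2 ^ suc p
  upper = subst₂ _≤_ (+-comm n 1) (cong (2 ^_) (≡-sym eq)) (≤2^⌈log₂⌉ (n + 1))
  lower : 2 ^ p ≤ n
  lower = ≮⇒≥ λ n<2^p →
    <-irrefl refl (subst (p <_) (⌈log₂2^n⌉≡n p)
      (≤-trans (≤-reflexive eq) (⌈log₂⌉-mono-≤ (subst (_≤ 2 ^ p) (+-comm 1 n) n<2^p))))

⌈log₂⌉-positive : ∀ {x} → 2 ≤ x → 0 < ⌈log₂ x ⌉
⌈log₂⌉-positive 2≤x = ⌈log₂⌉-mono-≤ 2≤x

splitter : ∀ {k} (G : Graph k) {M : Subset k} → IsModule G M → ∀ {p q s} →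
           M p ≡ true → M q ≡ true → adj G s p ≢ adj G s q → M s ≡ true
splitter G {M} M-module {p} {q} {s} Mp Mq s-splits with M s in Ms
... | true  = refl
... | false with M-module s Ms
...   | inj₁ sees-all  = contradiction (trans (sees-all p Mp) (≡-sym (sees-all q Mq))) s-splits
...   | inj₂ sees-none = contradiction (trans (sees-none p Mp) (≡-sym (sees-none q Mq))) s-splits

PairGenerates : ∀ {k} → Subset k → Set
PairGenerates {k} M = ∀ (u v : Fin k) → u ≢ v → M u ≡ true → M v ≡ true → ∀ w → M w ≡ true

trivial-if-pair-generates : ∀ {k} (M : Subset k) → PairGenerates M → IsTrivial M
trivial-if-pair-generates M generates with any? (λ u → M u ≟ᵇ true)
... | no  empty = inj₁ (λ u → ¬-not (λ Mu → empty (u , Mu)))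
... | yes (u , Mu) with any? (λ v → (M v ≟ᵇ true) ×-dec ¬? (v ≟ᶠ u))
...   | yes (v , Mv , v≢u) = inj₂ (inj₁ (generates v u v≢u Mv Mu))
...   | no  only-u         = inj₂ (inj₂ (u , Mu , λ v Mv →
          decidable-stable (v ≟ᶠ u) (λ v≢u → only-u (v , Mv , v≢u))))

module Bipartite {n m : ℕ} (R : Fin n → Fin m → Bool) where

  -- inj₁ i is the vertex i of the side S, inj₂ j the vertex j of the side S'.
  edge : Fin n ⊎ Fin m → Fin n ⊎ Fin m → Bool
  edge (inj₁ _) (inj₁ _) = false
  edge (inj₁ i) (inj₂ j) = R i j
  edge (inj₂ j) (inj₁ i) = R i j
  edge (inj₂ _) (inj₂ _) = false

  edge-sym : ∀ a b → edge a b ≡ edge b a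
  edge-sym (inj₁ _) (inj₁ _) = refl
  edge-sym (inj₁ _) (inj₂ _) = refl
  edge-sym (inj₂ _) (inj₁ _) = refl
  edge-sym (inj₂ _) (inj₂ _) = refl

  edge-irrefl : ∀ a → edge a a ≡ false
  edge-irrefl (inj₁ _) = refl
  edge-irrefl (inj₂ _) = refl

  -- The graph on Fin (n + m), whose first n vertices form S.
  graph : Graph (n + m)
  graph = record
    { adj    = λ u v → edge (splitAt n u) (splitAt n v)
    ; sym    = λ u v → edge-sym (splitAt n u) (splitAt n v)
    ; irrefl = λ v → edge-irrefl (splitAt n v)
    }

  vertex : Fin n ⊎ Fin m → Fin (n + m)
  vertex = join n m

  adj-vertex : ∀ a b → adj graph (vertex a) (vertex b) ≡ edge a b
  adj-vertex a b rewrite splitAt-join n m a | splitAt-join n m b = refl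

  coordinates : ∀ u → Σ (Fin n ⊎ Fin m) λ a → vertex a ≡ u
  coordinates u = splitAt n u , join-splitAt n m u

  S-stable : IsStable graph (λ v → [ (λ _ → true) , (λ _ → false) ] (splitAt n v))
  S-stable u v Su Sv with splitAt n u | splitAt n v
  ... | inj₁ _ | inj₁ _ = refl
  ... | inj₁ _ | inj₂ _ = contradiction Sv λ ()
  ... | inj₂ _ | _      = contradiction Su λ ()

  S'-stable : IsStable graph (λ v → [ (λ _ → false) , (λ _ → true) ] (splitAt n v))
  S'-stable u v S'u S'v with splitAt n u | splitAt n v
  ... | inj₂ _ | inj₂ _ = refl
  ... | inj₂ _ | inj₁ _ = contradiction S'v λ ()
  ... | inj₁ _ | _      = contradiction S'u λ ()

true≢false : ∀ {a b : Bool} → a ≡ true → b ≡ false → a ≢ b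
true≢false refl refl ()

-- The digit graph on S = {0, …, n-1} and S' = {0, …, m-1}, m = p + 1:
-- i ~ j iff the j-th digit of i is 0.  It is prime when n ≥ 2 and 2 ^ p ≤ n < 2 ^ m;
-- n is written 2 + n' so that the vertices 0 and 1 of S are available.

module DigitGraph (n' p : ℕ) (n<2^m : 2 + n' < 2 ^ suc p) (2^p≤n : 2 ^ p ≤ 2 + n') where

  n m : ℕ
  n = 2 + n'
  m = suc p

  digit-is-zero : Fin n → Fin m → Bool
  digit-is-zero i j = not (bit (toℕ i) (toℕ j))

  open Bipartite digit-is-zero public

  below-2^m : ∀ (i : Fin n) → toℕ i < 2 ^ m
  below-2^m i = <-trans (toℕ<n i) n<2^m

  below-2^m-1 : ∀ (i : Fin n) → suc (toℕ i) < 2 ^ m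
  below-2^m-1 i = ≤-<-trans (toℕ<n i) n<2^m

  zero-sees-S' : ∀ j → edge (inj₁ fzero) (inj₂ j) ≡ true
  zero-sees-S' j = cong not (bit-zero (toℕ j))

  -- Two positions j < k < m are separated by 2 ^ j ∈ S (it lies in S as j < p).
  power-separates : ∀ {j k : Fin m} → toℕ j < toℕ k →
                    Σ (Fin n) λ i → edge (inj₁ i) (inj₂ j) ≢ edge (inj₁ i) (inj₂ k)
  power-separates {j} {k} j<k = fromℕ< 2^j<n , separates
    where
    2^j<n : 2 ^ toℕ j < n
    2^j<n = <-≤-trans (^-monoʳ-< 2 (s≤s (s≤s z≤n)) (<-≤-trans j<k (≤-pred (toℕ<n k)))) 2^p≤n
    separates : edge (inj₁ (fromℕ< 2^j<n)) (inj₂ j) ≢ edge (inj₁ (fromℕ< 2^j<n)) (inj₂ k)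
    separates rewrite toℕ-fromℕ< 2^j<n | bit-pow-self (toℕ j)
                    | bit-pow-other (toℕ j) (toℕ k) (<⇒≢ j<k) = λ ()

  module _ {M : Subset (n + m)} (M-module : IsModule graph M) where

    In : Fin n ⊎ Fin m → Set
    In a = M (vertex a) ≡ true

    Full : Set
    Full = ∀ a → In a

    split : ∀ s a b → edge s a ≢ edge s b → In a → In b → In s
    split s a b s-splits Ma Mb = splitter graph M-module Ma Mb
      (λ e → s-splits (trans (≡-sym (adj-vertex s a)) (trans e (adj-vertex s b))))

    -- If S' ⊆ M then M is full: a nonzero i ∈ S has a digit 0 and a digit 1,
    -- so it splits two vertices of S'; and 0 splits 1 ∈ S from 0 ∈ S'.
    S'⊆M⇒full : (∀ j → In (inj₂ j)) → Full
    S'⊆M⇒full S'⊆M (inj₂ j) = S'⊆M j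
    S'⊆M⇒full S'⊆M (inj₁ i) = S⊆M i
      where
      nonzero∈M : ∀ i → toℕ i ≢ 0 → In (inj₁ i)
      nonzero∈M i i≢0 =
        let j , digit-j≡0 = zero-bit m (below-2^m-1 i)
            k , digit-k≢0 = bits-separate m (below-2^m i) (below-2^m fzero) i≢0
            digit-k≡1     = ¬-not (λ e → digit-k≢0 (trans e (≡-sym (bit-zero (toℕ k)))))
        in split (inj₁ i) (inj₂ j) (inj₂ k) (true≢false (cong not digit-j≡0) (cong not digit-k≡1))
                 (S'⊆M j) (S'⊆M k)
      S⊆M : ∀ i → In (inj₁ i)
      S⊆M fzero    = split (inj₁ fzero) (inj₁ (fsuc fzero)) (inj₂ fzero) (λ ()) (nonzero∈M (fsuc fzero) (λ ())) (S'⊆M fzero)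
      S⊆M (fsuc i) = nonzero∈M (fsuc i) (λ ())

    -- A member of S together with a member j of S' make M full: 0 ∈ S splits
    -- the pair (or is the member), and then 0 splits every k ∈ S' from j.
    mixed-pair⇒full : ∀ {i j} → In (inj₁ i) → In (inj₂ j) → Full
    mixed-pair⇒full {i} {j} Mi Mj = S'⊆M⇒full λ k →
      split (inj₂ k) (inj₁ fzero) (inj₂ j) (true≢false (zero-sees-S' k) refl) (zero∈M i Mi) Mj
      where
      zero∈M : ∀ i → In (inj₁ i) → In (inj₁ fzero)
      zero∈M fzero    M0 = M0
      zero∈M (fsuc i) Mi = split (inj₁ fzero) (inj₁ (fsuc i)) (inj₂ j) (≢-sym (true≢false (zero-sees-S' j) refl)) Mi Mj

    -- Two members of S differ in some digit j, and j ∈ S' splits them.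
    S-pair⇒full : ∀ {i i'} → i ≢ i' → In (inj₁ i) → In (inj₁ i') → Full
    S-pair⇒full {i} {i'} i≢i' Mi Mi' =
      let j , differs = bits-separate m (below-2^m i) (below-2^m i') (λ e → i≢i' (toℕ-injective e))
      in mixed-pair⇒full Mi (split (inj₂ j) (inj₁ i) (inj₁ i') (λ e → differs (not-injective e)) Mi Mi')

    -- Two members j < k of S' are split by 2 ^ j ∈ S.
    S'-pair⇒full : ∀ {j k : Fin m} → toℕ j < toℕ k → In (inj₂ j) → In (inj₂ k) → Full
    S'-pair⇒full {j} {k} j<k Mj Mk =
      let i , separates = power-separates j<k
      in mixed-pair⇒full (split (inj₁ i) (inj₂ j) (inj₂ k) separates Mj Mk) Mj

    pair⇒full : ∀ {a b} → a ≢ b → In a → In b → Full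
    pair⇒full {inj₁ _} {inj₁ _} a≢b Ma Mb = S-pair⇒full (λ e → a≢b (cong inj₁ e)) Ma Mb
    pair⇒full {inj₁ _} {inj₂ _} _   Ma Mb = mixed-pair⇒full Ma Mb
    pair⇒full {inj₂ _} {inj₁ _} _   Ma Mb = mixed-pair⇒full Mb Ma
    pair⇒full {inj₂ j} {inj₂ k} a≢b Ma Mb with <-cmp (toℕ j) (toℕ k)
    ... | tri< j<k _   _   = S'-pair⇒full j<k Ma Mb
    ... | tri≈ _   j≡k _   = contradiction (cong inj₂ (toℕ-injective j≡k)) a≢b
    ... | tri> _   _   k<j = S'-pair⇒full k<j Mb Ma

    pair-generates : PairGenerates M
    pair-generates u v u≢v Mu Mv w with coordinates u | coordinates v | coordinates w
    ... | a , refl | b , refl | c , refl = pair⇒full {a} {b} (λ e → u≢v (cong vertex e)) Mu Mv c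

  -- p = 0 would force n < 2, so p ≥ 1 and the graph has n + m ≥ 4 vertices.
  order≥4 : 4 ≤ n + m
  order≥4 = +-mono-≤ {2} {n} (s≤s (s≤s z≤n)) (p≥1 p n<2^m)
    where
    p≥1 : ∀ p → 2 + n' < 2 ^ suc p → 2 ≤ suc p
    p≥1 zero    (s≤s (s≤s ()))
    p≥1 (suc p) _ = s≤s (s≤s z≤n)

  prime : IsPrime graph
  prime = order≥4 , λ M M-module → trivial-if-pair-generates M (pair-generates M-module)

lemma2 : (n m : ℕ) → n ≥ 2 → m ≡ ⌈log₂ (n + 1) ⌉ →
    Σ (Graph (n + m)) λ G →
    IsPrime G
    × IsStable G (λ v → [ (λ _ → true) , (λ _ → false) ] (splitAt n v))
    × IsStable G (λ v → [ (λ _ → false) , (λ _ → true) ] (splitAt n v))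
lemma2 zero          _       ()
lemma2 (suc zero)    _       (s≤s ())
lemma2 (suc (suc n')) zero    n≥2 m≡log =
  contradiction (subst (0 <_) (≡-sym m≡log) (⌈log₂⌉-positive {suc (suc n') + 1} (s≤s (s≤s z≤n)))) λ ()
lemma2 (suc (suc n')) (suc p) n≥2 m≡log = graph , prime , S-stable , S'-stable
  where open DigitGraph n' p (proj₁ (log-bounds _ p m≡log)) (proj₂ (log-bounds _ p m≡log))
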